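{- In System $\mathsf{F}_{<:}^{K\top}$, if $\Theta\vdash_A R<:S$ and $\Theta\vdash_A S<:T$ then $\Theta\vdash_A R<:T$.
   Context: System $\mathsf{F}_{<:}^{K\top}$ types: $T ::= \top \mid X \mid T\to T \mid \forall^{K}(X<:T).T \mid \forall^{\top}(X<:T).T$ (up to $\alpha$-conversion). Contexts $\Theta$ are finite sequences of assumptions $X<:T$ (and $x:T$) with the usual well-formedness judgment $\Theta\vdash T$. The algorithmic subtyping relation $\Theta\vdash_A S<:T$ is generated by: $\Theta\vdash_A T<:\top$ (for $\Theta\vdash T$); $\Theta\vdash_A X<:X$ (for $\Theta\vdash X$); if $\Theta=\Theta_1,X<:S,\Theta_2$ and $\Theta\vdash_A S<:T$ with $T\not\equiv\top$ and $T\not\equiv X$, then $\Theta\vdash_A X<:T$; from $\Theta\vdash_A S'<:S$ and $\Theta\vdash_A T<:T'$ infer $\Theta\vdash_A S\to T<:S'\to T'$; from $\Theta,X<:S\vdash_A T<:T'$ infer $\Theta\vdash_A\forall^K(X<:S).T<:\forall^K(X<:S).T'$; from $\Theta\vdash_A T_0<:S_0$ and $\Theta,X<:S_0\vdash_A S_1<:T_1$ infer $\Theta\vdash_A\forall^K(X<:S_0).S_1<:\forall^\top(X<:T_0).T_1$; from $\Theta\vdash_A T_0<:S_0$ and $\Theta,X<:\top\vdash_A S_1<:T_1$ infer $\Theta\vdash_A\forall^\top(X<:S_0).S_1<:\forall^\top(X<:T_0).T_1$. -}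

module Defs where

open import Data.Nat using (ℕ; zero; suc)
open import Data.Fin using (Fin; zero; suc)
open import Relation.Binary.PropositionalEquality using (_≡_)
open import Relation.Nullary using (¬_)

-- Types of System F<:^{K⊤}, well-scoped de Bruijn representation
-- (so α-equivalent types are syntactically equal).  Ty n = types whose
-- free type variables are among n variables in scope.
data Ty (n : ℕ) : Set where
  ⊤'   : Ty n
  var  : Fin n → Ty n
  _⇒_  : Ty n → Ty n → Ty n
  ∀K   : Ty n → Ty (suc n) → Ty n
  ∀⊤   : Ty n → Ty (suc n) → Ty n

infixr 7 _⇒_

ext : ∀ {m n} → (Fin m → Fin n) → Fin (suc m) → Fin (suc n)
ext ρ zero    = zero
ext ρ (suc i) = suc (ρ i)

rename : ∀ {m n} → (Fin m → Fin n) → Ty m → Ty n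
rename ρ ⊤'        = ⊤'
rename ρ (var i)   = var (ρ i)
rename ρ (S ⇒ T)   = rename ρ S ⇒ rename ρ T
rename ρ (∀K S T)  = ∀K (rename ρ S) (rename (ext ρ) T)
rename ρ (∀⊤ S T)  = ∀⊤ (rename ρ S) (rename (ext ρ) T)

weaken : ∀ {n} → Ty n → Ty (suc n)
weaken = rename suc

-- The index counts the
-- type variables bound; term assumptions bind no type variable.
-- Well-formedness Θ ⊢ T is built into the scoping (T : Ty n).
data Ctx : ℕ → Set where
  ∅     : Ctx zero
  _,<:_ : ∀ {n} → Ctx n → Ty n → Ctx (suc n)
  _,∶_  : ∀ {n} → Ctx n → Ty n → Ctx n

infixl 5 _,<:_ _,∶_

bound : ∀ {n} → Ctx n → Fin n → Ty n
bound (Θ ,<: S) zero    = weaken S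
bound (Θ ,<: S) (suc X) = weaken (bound Θ X)
bound (Θ ,∶ T)  X       = bound Θ X

infix 4 _⊢A_<:_
data _⊢A_<:_ {n : ℕ} (Θ : Ctx n) : Ty n → Ty n → Set where
  SA-Top   : ∀ {T} → Θ ⊢A T <: ⊤'
  SA-Refl  : ∀ {X} → Θ ⊢A var X <: var X
  SA-Trans : ∀ {X T} → Θ ⊢A bound Θ X <: T → ¬ (T ≡ ⊤') → ¬ (T ≡ var X)
           → Θ ⊢A var X <: T
  SA-Arrow : ∀ {S S' T T'} → Θ ⊢A S' <: S → Θ ⊢A T <: T'
           → Θ ⊢A S ⇒ T <: S' ⇒ T'
  SA-AllK  : ∀ {S T T'} → (Θ ,<: S) ⊢A T <: T'
           → Θ ⊢A ∀K S T <: ∀K S T'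
  SA-AllK⊤ : ∀ {S₀ S₁ T₀ T₁} → Θ ⊢A T₀ <: S₀ → (Θ ,<: S₀) ⊢A S₁ <: T₁
           → Θ ⊢A ∀K S₀ S₁ <: ∀⊤ T₀ T₁
  SA-All⊤  : ∀ {S₀ S₁ T₀ T₁} → Θ ⊢A T₀ <: S₀ → (Θ ,<: ⊤') ⊢A S₁ <: T₁
           → Θ ⊢A ∀⊤ S₀ S₁ <: ∀⊤ T₀ T₁

-- Transitivity is proved by induction on the middle type S, with an inner
-- induction on the left derivation for the case where R is a variable.  The
-- only delicate case is ∀^K(X<:R₀).R₁ <: ∀^⊤(X<:S₀).S₁ <: ∀^⊤(X<:T₀).T₁: the
-- right body was checked under X <: ⊤ but must be composed with the left body,
-- checked under X <: R₀.  Narrowing a bound ⊤ to any R₀ is trivially admissible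
-- here, because a ⊤-bounded variable can never use SA-Trans: ⊤ lies only below ⊤,
-- which SA-Trans excludes, so no mutual induction with transitivity is needed.
module Submission where

open import Defs
open import Data.Nat using (ℕ)
open import Data.Fin using (zero; suc)
open import Data.Fin.Properties using (_≟_)
open import Data.Sum using (_⊎_; inj₁; inj₂)
open import Relation.Nullary using (yes; no; contradiction)
open import Relation.Binary.PropositionalEquality using (_≡_; refl; subst; cong)

⊤<:⇒≡⊤ : ∀ {n} {Θ : Ctx n} {T} → Θ ⊢A ⊤' <: T → T ≡ ⊤'
⊤<:⇒≡⊤ SA-Top = refl

Narrowing : ∀ {n} → Ctx n → Ctx n → Set
Narrowing Γ Δ = ∀ X → bound Γ X ≡ bound Δ X ⊎ bound Γ X ≡ ⊤'

Narrowing-,<: : ∀ {n} {Γ Δ : Ctx n} (U : Ty n) →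
                Narrowing Γ Δ → Narrowing (Γ ,<: U) (Δ ,<: U)
Narrowing-,<: U N zero = inj₁ refl
Narrowing-,<: U N (suc X) with N X
... | inj₁ eq = inj₁ (cong weaken eq)
... | inj₂ eq = inj₂ (cong weaken eq)

Narrowing-⊤ : ∀ {n} {Θ : Ctx n} (U : Ty n) → Narrowing (Θ ,<: ⊤') (Θ ,<: U)
Narrowing-⊤ U zero    = inj₂ refl
Narrowing-⊤ U (suc X) = inj₁ refl

narrow : ∀ {n} {Γ Δ : Ctx n} {S T} → Narrowing Γ Δ → Γ ⊢A S <: T → Δ ⊢A S <: T
narrow N SA-Top  = SA-Top
narrow N SA-Refl = SA-Refl
narrow {Γ = Γ} {Δ} N (SA-Trans {X} {T} d T≢⊤ T≢X) with N X
... | inj₁ eq = SA-Trans (subst (λ B → Δ ⊢A B <: T) eq (narrow N d)) T≢⊤ T≢X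
... | inj₂ eq = contradiction (⊤<:⇒≡⊤ (subst (λ B → Γ ⊢A B <: T) eq d)) T≢⊤
narrow N (SA-Arrow d e)          = SA-Arrow (narrow N d) (narrow N e)
narrow N (SA-AllK {S} d)         = SA-AllK (narrow (Narrowing-,<: S N) d)
narrow N (SA-AllK⊤ {S₀} d e)     = SA-AllK⊤ (narrow N d) (narrow (Narrowing-,<: S₀ N) e)
narrow N (SA-All⊤ d e)           = SA-All⊤ (narrow N d) (narrow (Narrowing-,<: ⊤' N) e)

-- SA-Trans without its side conditions: they are discharged by SA-Top and SA-Refl.
var<:-bound : ∀ {n} {Θ : Ctx n} {X} (T : Ty n) → Θ ⊢A bound Θ X <: T → Θ ⊢A var X <: T
var<:-bound ⊤' d = SA-Top
var<:-bound {X = X} (var Y) d with X ≟ Y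
... | yes refl = SA-Refl
... | no X≢Y   = SA-Trans d (λ ()) (λ { refl → X≢Y refl })
var<:-bound (A ⇒ B)  d = SA-Trans d (λ ()) (λ ())
var<:-bound (∀K A B) d = SA-Trans d (λ ()) (λ ())
var<:-bound (∀⊤ A B) d = SA-Trans d (λ ()) (λ ())

<:-trans : ∀ {n} {Θ : Ctx n} (S : Ty n) {R T} →
           Θ ⊢A R <: S → Θ ⊢A S <: T → Θ ⊢A R <: T
<:-trans S R<:S SA-Top             = SA-Top
<:-trans S (SA-Trans R<:S _ _) S<:T = var<:-bound _ (<:-trans S R<:S S<:T)
<:-trans S SA-Refl S<:T            = S<:T
<:-trans (S₀ ⇒ S₁) (SA-Arrow d₀ d₁) (SA-Arrow e₀ e₁) =
  SA-Arrow (<:-trans S₀ e₀ d₀) (<:-trans S₁ d₁ e₁)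
<:-trans (∀K S₀ S₁) (SA-AllK d) (SA-AllK e) = SA-AllK (<:-trans S₁ d e)
<:-trans (∀K S₀ S₁) (SA-AllK d) (SA-AllK⊤ e₀ e₁) = SA-AllK⊤ e₀ (<:-trans S₁ d e₁)
<:-trans (∀⊤ S₀ S₁) (SA-AllK⊤ {S₀ = R₀} d₀ d₁) (SA-All⊤ e₀ e₁) =
  SA-AllK⊤ (<:-trans S₀ e₀ d₀) (<:-trans S₁ d₁ (narrow (Narrowing-⊤ R₀) e₁))
<:-trans (∀⊤ S₀ S₁) (SA-All⊤ d₀ d₁) (SA-All⊤ e₀ e₁) =
  SA-All⊤ (<:-trans S₀ e₀ d₀) (<:-trans S₁ d₁ e₁)

mainTheorem11 : {n : ℕ} (Θ : Ctx n) (R S T : Ty n)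
    → Θ ⊢A R <: S → Θ ⊢A S <: T → Θ ⊢A R <: T
mainTheorem11 Θ R S T = <:-trans S
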